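{- Let $R$ be a finite group, identified with its right regular permutation representation, and let $G\leq\mathrm{Sym}(R)$ be a transitive group properly containing $R$. Let $G_1$ be the stabilizer of $1$ in $G$ and $K=\bigcap_{g\in G}R^g$; $G_1$ permutes the set $R/K$ of cosets $Kx$. Let $\Delta$ be an orbit of $G_1$ on $R/K$ and $\widetilde\Delta\subseteq R$ the union of the cosets in $\Delta$. Let $\mathcal{N}$ be the set of subsets $S\subseteq\widetilde\Delta$ that intersect $\widetilde\Delta$ evenly. Then $|\mathcal{N}|\leq 2^{|\widetilde\Delta|-|\Delta|+1}$.
   Context: $S$ intersects $\widetilde\Delta=\Lambda_1\cup\dots\cup\Lambda_b$ (a union of $K$-cosets) evenly if $|S\cap\Lambda_1|=\dots=|S\cap\Lambda_b|$. -}

module Defs where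

open import Level using (Level; 0ℓ; suc)
open import Data.Nat using (ℕ)
open import Data.Fin using (Fin)
open import Data.Fin.Permutation using (Permutation′; _⟨$⟩ʳ_; _⟨$⟩ˡ_; id; flip; _∘ₚ_)
open import Data.Fin.Subset using (Subset; _∈_)
open import Data.List using (List; length)
open import Data.List.Relation.Unary.All using (All)
open import Data.List.Relation.Unary.Any using (Any)
open import Data.List.Relation.Unary.AllPairs using (AllPairs)
open import Data.List.Relation.Unary.Unique.Propositional using (Unique)
import Data.List.Membership.Propositional as L
open import Data.Product using (Σ; ∃; ∃-syntax; _×_; _,_)
open import Relation.Nullary using (¬_)
open import Relation.Binary.PropositionalEquality using (_≡_)
open import Algebra.Core using (Op₁; Op₂)
open import Algebra.Structures using (IsGroup)

HasSize : {n : ℕ} → (Fin n → Set) → ℕ → Set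
HasSize {n} A c = Σ (List (Fin n)) λ xs →
  Unique xs × length xs ≡ c × (∀ x → (x L.∈ xs → A x) × (A x → x L.∈ xs))

record IsPermGroup {n : ℕ} (G : Permutation′ n → Set) : Set where
  field
    resp  : ∀ σ τ → (∀ x → σ ⟨$⟩ʳ x ≡ τ ⟨$⟩ʳ x) → G σ → G τ
    id∈   : G id
    ∘∈    : ∀ σ τ → G σ → G τ → G (σ ∘ₚ τ)
    inv∈  : ∀ σ → G σ → G (flip σ)

-- Setting: a finite group R with carrier Fin n, identified with its right
-- regular representation x ↦ x · r inside Sym(Fin n).
module Setting {n : ℕ} (_·_ : Op₂ (Fin n)) (e : Fin n) (inv : Op₁ (Fin n))
               (G : Permutation′ n → Set) where

  IsTranslation : Permutation′ n → Set
  IsTranslation σ = ∃[ r ] ∀ x → σ ⟨$⟩ʳ x ≡ x · r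

  RinG : Set
  RinG = ∀ r → ∃[ σ ] G σ × (∀ x → σ ⟨$⟩ʳ x ≡ x · r)

  Transitive : Set
  Transitive = ∀ x y → ∃[ σ ] G σ × σ ⟨$⟩ʳ x ≡ y

  ProperOverR : Set
  ProperOverR = ∃[ σ ] G σ × ¬ IsTranslation σ

  -- k ∈ K = ⋂_{g ∈ G} R^g : for every σ ∈ G, σ ρ_k σ⁻¹ is a right translation
  inK : Fin n → Set
  inK k = ∀ σ → G σ → ∃[ r ] ∀ x → σ ⟨$⟩ˡ ((σ ⟨$⟩ʳ x) · k) ≡ x · r

  -- x ∈ K y  (the coset Ky)
  inCoset : Fin n → Fin n → Set
  inCoset y x = inK (x · inv y)

  -- Δ̃ for the G₁-orbit Δ of the coset Ka: union of the cosets K σ(a), σ ∈ G₁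
  inΔ̃ : Fin n → Fin n → Set
  inΔ̃ a x = ∃[ σ ] G σ × σ ⟨$⟩ʳ e ≡ e × inCoset (σ ⟨$⟩ʳ a) x

  -- |Δ| = d : a list of d elements of Δ̃ lying in pairwise distinct K-cosets
  -- and meeting every K-coset contained in Δ̃.
  NumCosets : Fin n → ℕ → Set
  NumCosets a d = Σ (List (Fin n)) λ ys →
    length ys ≡ d × All (inΔ̃ a) ys
    × AllPairs (λ y y′ → ¬ inCoset y′ y) ys
    × (∀ x → inΔ̃ a x → Any (λ y → inCoset y x) ys)

  -- S ⊆ Δ̃ intersects Δ̃ evenly: all |S ∩ Ky| (Ky a coset in Δ) are equal
  inN : Fin n → Subset n → Set
  inN a S = (∀ x → x ∈ S → inΔ̃ a x)
    × ∃[ c ] ∀ y → inΔ̃ a y → HasSize (λ x → x ∈ S × inCoset y x) c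

{-# OPTIONS --safe #-}
-- Pick a representative in Δ̃ of each K-coset of Δ and fix one of them, z.
-- An evenly intersecting S is determined by its intersection with the
-- non-representatives together with the bit [z ∈ S]: these fix the common
-- value c = |S ∩ Kz|, and for any other representative y the rest of S ∩ Ky is
-- already known, so c decides whether y ∈ S.  There are |Δ̃| − |Δ|
-- non-representatives, whence the bound 2^(|Δ̃| − |Δ| + 1).  The only group
-- theory needed is that "x ∈ Ky" is symmetric, i.e. that K is closed under
-- inverses.
module Submission where

open import Level using (0ℓ)
open import Defs
open import Data.Nat using (ℕ; _≤_; _<_; _^_; _∸_; _+_; zero; suc; s≤s; z≤n)
open import Data.Nat.Properties
  using (<⇒≱; +-identityʳ; +-comm; ^-monoʳ-≤; m+n≤o⇒m≤o∸n; module ≤-Reasoning)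
open import Data.Bool using (Bool; true; false)
open import Data.Fin using (Fin; _≟_)
open import Data.Fin.Permutation as Perm using (Permutation′; _⟨$⟩ʳ_; _⟨$⟩ˡ_)
open import Data.Fin.Subset using (Subset; _⊆_) renaming (_∈_ to _∈ₛ_)
open import Data.Fin.Subset.Properties using (⊆-antisym) renaming (_∈?_ to _∈ₛ?_)
open import Data.List using (List; []; _∷_; [_]; length; map; _++_; filter)
open import Data.List.Properties using (length-map; length-++; length-removeAt′; ∷-injective)
open import Data.List.Relation.Unary.All as All using (All)
open import Data.List.Relation.Unary.All.Properties using () renaming (map⁺ to All-map⁺)
open import Data.List.Relation.Unary.Any using (here; there; _─_)
open import Data.List.Relation.Unary.AllPairs as AllPairs using (AllPairs; []; _∷_)
open import Data.List.Relation.Unary.Unique.Propositional using (Unique)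
import Data.List.Relation.Unary.Unique.Propositional.Properties as Unique
open import Data.List.Membership.Propositional using (_∈_; _∉_; find)
open import Data.List.Membership.Propositional.Properties
  using (∈-map⁺; ∈-map⁻; ∈-++⁺ˡ; ∈-++⁺ʳ; ∈-++⁻; ∈-filter⁺; ∈-filter⁻)
import Data.List.Membership.DecPropositional as DecMembership
open import Data.Vec using (lookup)
open import Data.Vec.Properties using (lookup⇒[]=; []=⇒lookup)
open import Data.Product using (∃; _×_; _,_; proj₁; proj₂)
open import Function using (_∘_)
open import Data.Sum using (_⊎_; inj₁; inj₂)
open import Data.Empty using (⊥-elim)
open import Relation.Nullary using (¬_; yes; no; ¬?)
open import Relation.Binary.Core using (Rel)
open import Relation.Binary.Definitions using (Symmetric)
open import Relation.Binary.PropositionalEquality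
  using (_≡_; _≢_; refl; sym; trans; cong; cong₂; subst; ≢-sym; module ≡-Reasoning)
open import Algebra.Core using (Op₁; Op₂)
open import Algebra.Structures using (IsGroup)
open import Algebra.Bundles using (Group)
import Algebra.Properties.Group as GroupProperties

module _ {A : Set} where

  ∈-─ : ∀ {x y} (xs : List A) (x∈xs : x ∈ xs) → y ∈ xs → y ≢ x → y ∈ (xs ─ x∈xs)
  ∈-─ (_ ∷ _)  (here refl)  (here refl)  y≢x = ⊥-elim (y≢x refl)
  ∈-─ (_ ∷ _)  (here _)     (there y∈xs) _   = y∈xs
  ∈-─ (_ ∷ _)  (there _)    (here refl)  _   = here refl
  ∈-─ (_ ∷ xs) (there x∈xs) (there y∈xs) y≢x = there (∈-─ xs x∈xs y∈xs y≢x)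

  Unique-⊆⇒length≤ : ∀ {xs ys : List A} → Unique xs → (∀ {x} → x ∈ xs → x ∈ ys) →
                     length xs ≤ length ys
  Unique-⊆⇒length≤ {[]}          _            _     = z≤n
  Unique-⊆⇒length≤ {x ∷ xs} {ys} (x∉xs ∷ xs!) xs⊆ys = begin
    suc (length xs)          ≤⟨ s≤s (Unique-⊆⇒length≤ xs! xs⊆ys─x) ⟩
    suc (length (ys ─ x∈ys)) ≡⟨ length-removeAt′ ys _ ⟨
    length ys                ∎
    where
    open ≤-Reasoning
    x∈ys : x ∈ ys
    x∈ys = xs⊆ys (here refl)
    xs⊆ys─x : ∀ {y} → y ∈ xs → y ∈ (ys ─ x∈ys)
    xs⊆ys─x y∈xs = ∈-─ ys x∈ys (xs⊆ys (there y∈xs)) (≢-sym (All.lookup x∉xs y∈xs))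

  AllPairs-lookup₂ : ∀ {R : Rel A 0ℓ} {xs x y} → Symmetric R → AllPairs R xs →
                     x ∈ xs → y ∈ xs → x ≡ y ⊎ R x y
  AllPairs-lookup₂ _   _         (here refl) (here refl) = inj₁ refl
  AllPairs-lookup₂ _   (Rx ∷ _)  (here refl) (there y∈)  = inj₂ (All.lookup Rx y∈)
  AllPairs-lookup₂ sym (Rx ∷ _)  (there x∈)  (here refl) = inj₂ (sym (All.lookup Rx x∈))
  AllPairs-lookup₂ sym (_ ∷ Rxs) (there x∈)  (there y∈)  = AllPairs-lookup₂ sym Rxs x∈ y∈

  Unique-map⁺ : ∀ {B : Set} (f : A → B) {xs} →
                (∀ {x y} → x ∈ xs → y ∈ xs → f x ≡ f y → x ≡ y) →
                Unique xs → Unique (map f xs)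
  Unique-map⁺ f         _   []           = []
  Unique-map⁺ f {x ∷ _} inj (x∉xs ∷ xs!) =
    All-map⁺ (All.tabulate λ y∈ fx≡fy → All.lookup x∉xs y∈ (inj (here refl) (there y∈) fx≡fy))
    ∷ Unique-map⁺ f (λ x∈ y∈ → inj (there x∈) (there y∈)) xs!

  map-≡⇒≡ : ∀ {B : Set} {f g : A → B} {xs x} → map f xs ≡ map g xs → x ∈ xs → f x ≡ g x
  map-≡⇒≡ {xs = _ ∷ _} eq (here refl) = proj₁ (∷-injective eq)
  map-≡⇒≡ {xs = _ ∷ _} eq (there x∈)  = map-≡⇒≡ (proj₂ (∷-injective eq)) x∈

bitStrings : ℕ → List (List Bool)
bitStrings zero    = [ [] ]
bitStrings (suc m) = map (true ∷_) (bitStrings m) ++ map (false ∷_) (bitStrings m)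

length-bitStrings : ∀ m → length (bitStrings m) ≡ 2 ^ m
length-bitStrings zero    = refl
length-bitStrings (suc m) = begin
  length (map (true ∷_) bits ++ map (false ∷_) bits)         ≡⟨ length-++ (map (true ∷_) bits) ⟩
  length (map (true ∷_) bits) + length (map (false ∷_) bits) ≡⟨ cong₂ _+_ (length-map _ bits) (length-map _ bits) ⟩
  length bits + length bits                                  ≡⟨ cong₂ _+_ ih ih ⟩
  2 ^ m + 2 ^ m                                              ≡⟨ cong (2 ^ m +_) (+-identityʳ (2 ^ m)) ⟨
  2 ^ suc m                                                  ∎
  where
  open ≡-Reasoning
  bits : List (List Bool)
  bits = bitStrings m
  ih : length bits ≡ 2 ^ m
  ih = length-bitStrings m

∈-bitStrings : ∀ {m} (bs : List Bool) → length bs ≡ m → bs ∈ bitStrings m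
∈-bitStrings []           refl = here refl
∈-bitStrings (true ∷ bs)  refl = ∈-++⁺ˡ (∈-map⁺ (true ∷_) (∈-bitStrings bs refl))
∈-bitStrings (false ∷ bs) refl = ∈-++⁺ʳ (map (true ∷_) _) (∈-map⁺ (false ∷_) (∈-bitStrings bs refl))

injective-code⇒length≤2^ : ∀ {A : Set} {m} (code : A → List Bool) → (∀ x → length (code x) ≡ m) →
                           ∀ {xs} → Unique xs → (∀ {x y} → x ∈ xs → y ∈ xs → code x ≡ code y → x ≡ y) →
                           length xs ≤ 2 ^ m
injective-code⇒length≤2^ {m = m} code length-code {xs} xs! inj = begin
  length xs               ≡⟨ length-map code xs ⟨
  length (map code xs)    ≤⟨ Unique-⊆⇒length≤ (Unique-map⁺ code inj xs!) codes⊆bitStrings ⟩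
  length (bitStrings m)   ≡⟨ length-bitStrings m ⟩
  2 ^ m                   ∎
  where
  open ≤-Reasoning
  codes⊆bitStrings : ∀ {bs} → bs ∈ map code xs → bs ∈ bitStrings m
  codes⊆bitStrings bs∈ with ∈-map⁻ code bs∈
  ... | x , _ , refl = ∈-bitStrings (code x) (length-code x)

module _ {n : ℕ} {P Q : Fin n → Set} {c c′ : ℕ} where

  HasSize-mono : HasSize P c → HasSize Q c′ → (∀ x → P x → Q x) → c ≤ c′
  HasSize-mono (xs , xs! , refl , xs≐P) (ys , _ , refl , ys≐Q) P⊆Q =
    Unique-⊆⇒length≤ xs! λ {x} x∈xs → proj₂ (ys≐Q x) (P⊆Q x (proj₁ (xs≐P x) x∈xs))

  HasSize-strict : HasSize P c → HasSize Q c′ → (∀ x → P x → Q x) →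
                   ∀ {z} → ¬ P z → Q z → c < c′
  HasSize-strict (xs , xs! , refl , xs≐P) (ys , _ , refl , ys≐Q) P⊆Q {z} ¬Pz Qz =
    Unique-⊆⇒length≤ (z∉xs ∷ xs!) z∷xs⊆ys
    where
    z∉xs : All (z ≢_) xs
    z∉xs = All.tabulate λ {x} x∈xs z≡x → ¬Pz (subst P (sym z≡x) (proj₁ (xs≐P x) x∈xs))
    z∷xs⊆ys : ∀ {x} → x ∈ z ∷ xs → x ∈ ys
    z∷xs⊆ys     (here refl)  = proj₂ (ys≐Q z) Qz
    z∷xs⊆ys {x} (there x∈xs) = proj₂ (ys≐Q x) (P⊆Q x (proj₁ (xs≐P x) x∈xs))

lookup-≡⇒∈ : ∀ {n} {S S′ : Subset n} {x} → lookup S x ≡ lookup S′ x → x ∈ₛ S → x ∈ₛ S′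
lookup-≡⇒∈ {S′ = S′} {x} eq x∈S = lookup⇒[]= x S′ (trans (sym eq) ([]=⇒lookup x∈S))

module Cosets {n : ℕ} {_·_ : Op₂ (Fin n)} {e : Fin n} {inv : Op₁ (Fin n)}
              (isGroup : IsGroup _≡_ _·_ e inv) (G : Permutation′ n → Set) where

  open Setting _·_ e inv G
  open IsGroup isGroup using (identityʳ; inverseʳ; _//_)

  private
    group : Group 0ℓ 0ℓ
    group = record { isGroup = isGroup }

  open GroupProperties group using (//-rightDividesˡ; //-rightDividesʳ; ⁻¹-anti-homo-//)

  e∈K : inK e
  e∈K σ _ = e , λ x → begin
    σ ⟨$⟩ˡ ((σ ⟨$⟩ʳ x) · e) ≡⟨ cong (σ ⟨$⟩ˡ_) (identityʳ _) ⟩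
    σ ⟨$⟩ˡ (σ ⟨$⟩ʳ x)       ≡⟨ Perm.inverseˡ σ ⟩
    x                       ≡⟨ identityʳ x ⟨
    x · e                   ∎
    where open ≡-Reasoning

  inv∈K : ∀ {k} → inK k → inK (inv k)
  -- If σ⁻¹ ρₖ σ = ρᵣ then σ⁻¹ ρₖ⁻¹ σ = ρᵣ⁻¹, evaluated at x via the point x // r.
  inv∈K {k} k∈K σ σ∈G with k∈K σ σ∈G
  ... | r , conj = inv r , λ x → begin
    σ ⟨$⟩ˡ ((σ ⟨$⟩ʳ x) // k)               ≡⟨ cong (λ u → σ ⟨$⟩ˡ (u // k)) (σ[x//r]·k≡σx x) ⟨
    σ ⟨$⟩ˡ (((σ ⟨$⟩ʳ (x // r)) · k) // k) ≡⟨ cong (σ ⟨$⟩ˡ_) (//-rightDividesʳ _ _) ⟩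
    σ ⟨$⟩ˡ (σ ⟨$⟩ʳ (x // r))               ≡⟨ Perm.inverseˡ σ ⟩
    x // r                                 ∎
    where
    open ≡-Reasoning
    σ[x//r]·k≡σx : ∀ x → (σ ⟨$⟩ʳ (x // r)) · k ≡ σ ⟨$⟩ʳ x
    σ[x//r]·k≡σx x = begin
      (σ ⟨$⟩ʳ (x // r)) · k                    ≡⟨ Perm.inverseʳ σ ⟨
      σ ⟨$⟩ʳ (σ ⟨$⟩ˡ ((σ ⟨$⟩ʳ (x // r)) · k)) ≡⟨ cong (σ ⟨$⟩ʳ_) (conj (x // r)) ⟩
      σ ⟨$⟩ʳ ((x // r) · r)                    ≡⟨ cong (σ ⟨$⟩ʳ_) (//-rightDividesˡ r x) ⟩
      σ ⟨$⟩ʳ x                                 ∎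

  inCoset-refl : ∀ y → inCoset y y
  inCoset-refl y = subst inK (sym (inverseʳ y)) e∈K

  inCoset-sym : ∀ {x y} → inCoset y x → inCoset x y
  inCoset-sym {x} {y} x∈Ky = subst inK (⁻¹-anti-homo-// x y) (inv∈K x∈Ky)

module EvenlyIntersecting {n : ℕ} {_·_ : Op₂ (Fin n)} {e : Fin n} {inv : Op₁ (Fin n)}
                          (isGroup : IsGroup _≡_ _·_ e inv)
                          {G : Permutation′ n → Set} (isPermGroup : IsPermGroup G) (a : Fin n) where

  open Setting _·_ e inv G
  open Cosets isGroup G
  open IsPermGroup isPermGroup using (id∈)
  open DecMembership (_≟_ {n}) using (_∈?_)

  a∈Δ̃ : inΔ̃ a a
  a∈Δ̃ = Perm.id , id∈ , refl , inCoset-refl a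

  count : ∀ {S} → inN a S → ℕ
  count = proj₁ ∘ proj₂

  count-sizes : ∀ {S} (S∈N : inN a S) y → inΔ̃ a y → HasSize (λ x → x ∈ₛ S × inCoset y x) (count S∈N)
  count-sizes = proj₂ ∘ proj₂

  module Representatives (ys : List (Fin n)) (ys⊆Δ̃ : All (inΔ̃ a) ys)
                         (ys-inequivalent : AllPairs (λ y y′ → ¬ inCoset y′ y) ys) where

    ys-unique : Unique ys
    ys-unique = AllPairs.map
      (λ {y} {y′} y∉Ky′ y≡y′ → y∉Ky′ (subst (inCoset y′) (sym y≡y′) (inCoset-refl y′)))
      ys-inequivalent

    rep-unique : ∀ {y x} → y ∈ ys → x ∈ ys → inCoset y x → x ≡ y
    rep-unique y∈ys x∈ys x∈Ky
      with AllPairs-lookup₂ (λ y∉Kx x∈Ky → y∉Kx (inCoset-sym x∈Ky)) ys-inequivalent x∈ys y∈ys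
    ... | inj₁ x≡y  = x≡y
    ... | inj₂ x∉Ky = ⊥-elim (x∉Ky x∈Ky)

    AgreeOffReps : Subset n → Subset n → Set
    AgreeOffReps S S′ = ∀ x → inΔ̃ a x → x ∉ ys → x ∈ₛ S → x ∈ₛ S′

    coset-transfer : ∀ {S S′} → inN a S → AgreeOffReps S S′ →
                     ∀ {y x} → y ∈ ys → inCoset y x → x ≢ y → x ∈ₛ S → x ∈ₛ S′
    coset-transfer S∈N agree y∈ys x∈Ky x≢y x∈S =
      agree _ (proj₁ S∈N _ x∈S) (λ x∈ys → x≢y (rep-unique y∈ys x∈ys x∈Ky)) x∈S

    module _ {S S′ : Subset n} (S∈N : inN a S) (S′∈N : inN a S′) where

      count-mono : AgreeOffReps S S′ → ∀ {z} → z ∈ ys → (z ∈ₛ S → z ∈ₛ S′) → count S∈N ≤ count S′∈N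
      count-mono agree {z} z∈ys agree-z =
        HasSize-mono (count-sizes S∈N z z∈Δ̃) (count-sizes S′∈N z z∈Δ̃) S∩Kz⊆S′
        where
        z∈Δ̃ : inΔ̃ a z
        z∈Δ̃ = All.lookup ys⊆Δ̃ z∈ys
        S∩Kz⊆S′ : ∀ x → x ∈ₛ S × inCoset z x → x ∈ₛ S′ × inCoset z x
        S∩Kz⊆S′ x (x∈S , x∈Kz) with x ≟ z
        ... | yes refl = agree-z x∈S , x∈Kz
        ... | no x≢z   = coset-transfer S∈N agree z∈ys x∈Kz x≢z x∈S , x∈Kz

      rep-forced : AgreeOffReps S′ S → count S∈N ≤ count S′∈N → ∀ {y} → y ∈ ys → y ∈ₛ S → y ∈ₛ S′
      rep-forced agree′ c≤c′ {y} y∈ys y∈S with y ∈ₛ? S′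
      ... | yes y∈S′ = y∈S′
      ... | no  y∉S′ = ⊥-elim (<⇒≱ c′<c c≤c′)
        where
        y∈Δ̃ : inΔ̃ a y
        y∈Δ̃ = All.lookup ys⊆Δ̃ y∈ys
        S′∩Ky⊆S : ∀ x → x ∈ₛ S′ × inCoset y x → x ∈ₛ S × inCoset y x
        S′∩Ky⊆S x (x∈S′ , x∈Ky) =
          coset-transfer S′∈N agree′ y∈ys x∈Ky (λ { refl → y∉S′ x∈S′ }) x∈S′ , x∈Ky
        c′<c : count S′∈N < count S∈N
        c′<c = HasSize-strict (count-sizes S′∈N y y∈Δ̃) (count-sizes S∈N y y∈Δ̃) S′∩Ky⊆S
                              (λ (y∈S′ , _) → y∉S′ y∈S′) (y∈S , inCoset-refl y)

      determined-⊆ : ∀ {z} → z ∈ ys → (z ∈ₛ S → z ∈ₛ S′) → AgreeOffReps S S′ → AgreeOffReps S′ S → S ⊆ S′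
      determined-⊆ z∈ys agree-z agree agree′ {x} x∈S with x ∈? ys
      ... | yes x∈ys = rep-forced agree′ (count-mono agree z∈ys agree-z) x∈ys x∈S
      ... | no  x∉ys = agree x (proj₁ S∈N x x∈S) x∉ys x∈S

    determined : ∀ {S S′} → inN a S → inN a S′ → ∀ {z} → z ∈ ys →
                 (z ∈ₛ S → z ∈ₛ S′) → (z ∈ₛ S′ → z ∈ₛ S) → AgreeOffReps S S′ → AgreeOffReps S′ S → S ≡ S′
    determined S∈N S′∈N z∈ys agree-z agree-z′ agree agree′ =
      ⊆-antisym (determined-⊆ S∈N S′∈N z∈ys agree-z agree agree′)
                (determined-⊆ S′∈N S∈N z∈ys agree-z′ agree′ agree)

    module Codes (xs : List (Fin n)) (xs-unique : Unique xs)
                 (xs≐Δ̃ : ∀ x → (x ∈ xs → inΔ̃ a x) × (inΔ̃ a x → x ∈ xs)) where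

      nonReps : List (Fin n)
      nonReps = filter (λ x → ¬? (x ∈? ys)) xs

      length-nonReps+length-reps≤ : length nonReps + length ys ≤ length xs
      length-nonReps+length-reps≤ = begin
        length nonReps + length ys ≡⟨ length-++ nonReps ⟨
        length (nonReps ++ ys)     ≤⟨ Unique-⊆⇒length≤ nonReps++ys-unique nonReps++ys⊆xs ⟩
        length xs                  ∎
        where
        open ≤-Reasoning
        nonReps++ys-unique : Unique (nonReps ++ ys)
        nonReps++ys-unique = Unique.++⁺ (Unique.filter⁺ _ xs-unique) ys-unique
          λ (x∈nonReps , x∈ys) → proj₂ (∈-filter⁻ _ {xs = xs} x∈nonReps) x∈ys
        nonReps++ys⊆xs : ∀ {x} → x ∈ nonReps ++ ys → x ∈ xs
        nonReps++ys⊆xs {x} x∈ with ∈-++⁻ nonReps x∈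
        ... | inj₁ x∈nonReps = proj₁ (∈-filter⁻ _ {xs = xs} x∈nonReps)
        ... | inj₂ x∈ys      = proj₂ (xs≐Δ̃ x) (All.lookup ys⊆Δ̃ x∈ys)

      code : Fin n → Subset n → List Bool
      code z S = map (lookup S) (z ∷ nonReps)

      code-injective : ∀ {z S S′} → z ∈ ys → inN a S → inN a S′ → code z S ≡ code z S′ → S ≡ S′
      code-injective {z} {S} {S′} z∈ys S∈N S′∈N codes≡ =
        determined S∈N S′∈N z∈ys (lookup-≡⇒∈ same-z) (lookup-≡⇒∈ (sym same-z))
                   (agree (map-≡⇒≡ codes≡)) (agree (sym ∘ map-≡⇒≡ codes≡))
        where
        same-z : lookup S z ≡ lookup S′ z
        same-z = map-≡⇒≡ codes≡ (here refl)
        agree : ∀ {T T′} → (∀ {x} → x ∈ z ∷ nonReps → lookup T x ≡ lookup T′ x) → AgreeOffReps T T′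
        agree same x x∈Δ̃ x∉ys = lookup-≡⇒∈ (same (there (∈-filter⁺ _ (proj₂ (xs≐Δ̃ x) x∈Δ̃) x∉ys)))

      length-evenlyIntersecting≤ : ∀ {z Ss} → z ∈ ys → Unique Ss → All (inN a) Ss →
                                   length Ss ≤ 2 ^ suc (length nonReps)
      length-evenlyIntersecting≤ {z} z∈ys Ss-unique Ss⊆N =
        injective-code⇒length≤2^ (code z) (λ S → length-map (lookup S) (z ∷ nonReps)) Ss-unique
          λ S∈Ss S′∈Ss → code-injective z∈ys (All.lookup Ss⊆N S∈Ss) (All.lookup Ss⊆N S′∈Ss)

lemma3p9 : (n : ℕ) (_·_ : Op₂ (Fin n)) (e : Fin n) (inv : Op₁ (Fin n))
    → IsGroup _≡_ _·_ e inv
    → (G : Permutation′ n → Set) → IsPermGroup G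
    → Setting.RinG _·_ e inv G
    → Setting.Transitive _·_ e inv G
    → Setting.ProperOverR _·_ e inv G
    → (a : Fin n) (D d : ℕ)
    → HasSize (Setting.inΔ̃ _·_ e inv G a) D
    → Setting.NumCosets _·_ e inv G a d
    → (Ss : List (Subset n)) → Unique Ss
    → All (Setting.inN _·_ e inv G a) Ss
    → length Ss ≤ 2 ^ (D ∸ d + 1)
lemma3p9 n _·_ e inv isGroup G isPermGroup _ _ _ a D d
         (xs , xs-unique , refl , xs≐Δ̃) (ys , refl , ys⊆Δ̃ , ys-inequivalent , ys-cover) Ss Ss-unique Ss⊆N =
  begin
    length Ss                          ≤⟨ length-evenlyIntersecting≤ (proj₂ some-rep) Ss-unique Ss⊆N ⟩
    2 ^ suc (length nonReps)           ≤⟨ ^-monoʳ-≤ 2 1+nonReps≤ ⟩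
    2 ^ (length xs ∸ length ys + 1)    ∎
  where
  open ≤-Reasoning
  open EvenlyIntersecting isGroup isPermGroup a
  open Representatives ys ys⊆Δ̃ ys-inequivalent
  open Codes xs xs-unique xs≐Δ̃
  some-rep : ∃ (_∈ ys)
  some-rep = let z , z∈ys , _ = find (ys-cover a a∈Δ̃) in z , z∈ys
  1+nonReps≤ : suc (length nonReps) ≤ length xs ∸ length ys + 1
  1+nonReps≤ = subst (suc (length nonReps) ≤_) (+-comm 1 _)
                     (s≤s (m+n≤o⇒m≤o∸n (length nonReps) length-nonReps+length-reps≤))
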